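{- Let $\mathcal{CS}$ be a $\mathsf{C}$-axiomatically appropriate constant specification and $A$ a formula. (1) For any $t\in\mathrm{Tm}_{\mathsf{C}}$ there is a term $u\in\mathrm{Tm}_{\mathsf{C}}$ such that $\vdash_{\mathcal{CS}} t{:}_{\mathsf{C}}A\to u{:}_{\mathsf{C}}\,t{:}_{\mathsf{C}}A$. (2) For any $t\in\mathrm{Tm}_{\mathsf{C}}$ there is a term $u\in\mathrm{Tm}_{\mathsf{C}}$ such that $\vdash_{\mathcal{CS}} t{:}_{\mathsf{C}}A\to u{:}_{\mathsf{C}}\,\mathsf{hd}(t){:}_{\mathsf{E}}A$.
   Context: Fix a number $h\ge 1$ of agents. Throughout, $i$ ranges over $\{1,\dots,h\}$, $*$ over $\{1,\dots,h,\mathsf{C}\}$, and $\circledast$ over $\{1,\dots,h,\mathsf{E},\mathsf{C}\}$. For each $\circledast$ let $\mathrm{Cons}_\circledast$ (proof constants) and $\mathrm{Var}_\circledast$ (proof variables) be countably infinite sets, all pairwise disjoint. Evidence terms $\mathrm{Tm}_1,\dots,\mathrm{Tm}_h,\mathrm{Tm}_{\mathsf{E}},\mathrm{Tm}_{\mathsf{C}}$ are defined by simultaneous induction: $\mathrm{Cons}_\circledast\cup\mathrm{Var}_\circledast\subseteq\mathrm{Tm}_\circledast$; if $t\in\mathrm{Tm}_i$ then $!_i t\in\mathrm{Tm}_i$; if $t,s\in\mathrm{Tm}_*$ then $t+_*s,\ t\cdot_* s\in\mathrm{Tm}_*$; if $t_1\in\mathrm{Tm}_1,\dots,t_h\in\mathrm{Tm}_h$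 then $\langle t_1,\dots,t_h\rangle\in\mathrm{Tm}_{\mathsf{E}}$; if $t\in\mathrm{Tm}_{\mathsf{E}}$ then $\pi_i t\in\mathrm{Tm}_i$; if $t\in\mathrm{Tm}_{\mathsf{C}}$ then $\mathsf{hd}(t),\mathsf{tl}(t)\in\mathrm{Tm}_{\mathsf{E}}$; if $t\in\mathrm{Tm}_{\mathsf{C}}$ and $s\in\mathrm{Tm}_{\mathsf{E}}$ then $\mathsf{ind}(t,s)\in\mathrm{Tm}_{\mathsf{C}}$. Formulae are built from a countable set $\mathrm{Prop}$ of propositional variables using $\neg,\wedge,\vee,\to$ and the rule: if $A$ is a formula and $t\in\mathrm{Tm}_\circledast$ then $t{:}_\circledast A$ is a formula (indices on $!,+,\cdot$ omitted when clear). Axioms of $\mathsf{LP}^{\mathsf{C}}_h$ (all instances): (1) propositional tautologies; (2) $t{:}_*(A\to B)\to(s{:}_*A\to (t\cdot s){:}_*B)$; (3) $t{:}_*A\to(t+s){:}_*A$ and $s{:}_*A\to(t+s){:}_*A$; (4) $t{:}_iA\to A$; (5) $t{:}_iA\to (!t){:}_i\, t{:}_iA$; (6) $t_1{:}_1A\wedge\dots\wedge t_h{:}_hA\to\langle t_1,\dots,t_h\rangle{:}_{\mathsf{E}}A$; (7) $t{:}_{\mathsf{E}}A\to (\pi_it){:}_iA$; (8) $t{:}_{\mathsf{C}}A\to\mathsf{hd}(t){:}_{\mathsf{E}}A$ and $t{:}_{\mathsf{C}}A\to\mathsf{tl}(t){:}_{\mathsf{E}}\,t{:}_{\mathsf{C}}A$;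 (9) $A\wedge t{:}_{\mathsf{C}}(A\to s{:}_{\mathsf{E}}A)\to\mathsf{ind}(t,s){:}_{\mathsf{C}}A$. A constant specification $\mathcal{CS}$ is any set of formulae $c{:}_\circledast A$ with $c\in\mathrm{Cons}_\circledast$ and $A$ an axiom. It is $\mathsf{C}$-axiomatically appropriate if for each axiom $A$ there is $c\in\mathrm{Cons}_{\mathsf{C}}$ with $c{:}_{\mathsf{C}}A\in\mathcal{CS}$. $\mathsf{LP}^{\mathsf{C}}_h(\mathcal{CS})$ is the Hilbert system with these axioms, modus ponens, and axiom necessitation (derive $c{:}_\circledast A$ whenever $c{:}_\circledast A\in\mathcal{CS}$); $\vdash_{\mathcal{CS}}A$ means $A$ is derivable in it. -}

module Defs where

open import Data.Nat using (ℕ)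
open import Data.Fin using (Fin)
open import Data.Bool using (Bool; true; false; not; _∧_; _∨_)
open import Data.Product using (Σ; _×_; ∃)
open import Relation.Binary.PropositionalEquality using (_≡_)

-- Sorts of evidence: agents i ∈ Fin h, E (everybody), C (common).
data Idx (h : ℕ) : Set where
  ag : Fin h → Idx h
  E  : Idx h
  C  : Idx h

data Star {h : ℕ} : Idx h → Set where
  star-ag : (i : Fin h) → Star (ag i)
  star-C  : Star C

-- Evidence terms, indexed by their sort.  Cons_⊛ and Var_⊛ are copies of ℕ,
-- tagged by sort and by constructor, hence countably infinite and pairwise disjoint.
data Tm (h : ℕ) : Idx h → Set where
  cons : (k : Idx h) → ℕ → Tm h k
  var  : (k : Idx h) → ℕ → Tm h k
  !_   : {i : Fin h} → Tm h (ag i) → Tm h (ag i)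
  plus : {k : Idx h} → Star k → Tm h k → Tm h k → Tm h k
  app  : {k : Idx h} → Star k → Tm h k → Tm h k → Tm h k
  tup  : ((i : Fin h) → Tm h (ag i)) → Tm h E
  proj : (i : Fin h) → Tm h E → Tm h (ag i)
  hd   : Tm h C → Tm h E
  tl   : Tm h C → Tm h E
  ind  : Tm h C → Tm h E → Tm h C

data Fm (h : ℕ) : Set where
  atom : ℕ → Fm h
  ¬'_  : Fm h → Fm h
  _∧'_ : Fm h → Fm h → Fm h
  _∨'_ : Fm h → Fm h → Fm h
  _⇒_  : Fm h → Fm h → Fm h
  jst  : (k : Idx h) → Tm h k → Fm h → Fm h

infixr 5 _⇒_

-- Propositional evaluation, treating justification formulas t:A as atoms.
eval : {h : ℕ} → (ℕ → Bool) → ((k : Idx h) → Tm h k → Fm h → Bool) → Fm h → Bool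
eval v w (atom p) = v p
eval v w (¬' A) = not (eval v w A)
eval v w (A ∧' B) = eval v w A ∧ eval v w B
eval v w (A ∨' B) = eval v w A ∨ eval v w B
eval v w (A ⇒ B) = not (eval v w A) ∨ eval v w B
eval v w (jst k t A) = w k t A

Tautology : {h : ℕ} → Fm h → Set
Tautology A = ∀ v w → eval v w A ≡ true

bigAnd : {h : ℕ} → (n : ℕ) → (Fin (ℕ.suc n) → Fm h) → Fm h
bigAnd ℕ.zero f = f Fin.zero
bigAnd (ℕ.suc n) f = f Fin.zero ∧' bigAnd n (λ j → f (Fin.suc j))

-- Conjunction over all agents; for h = 0 (excluded by the standing assumption h ≥ 1)
-- we use the empty conjunction, rendered as a tautology ¬(p₀ ∧ ¬p₀).
allAgents : {h : ℕ} → ((i : Fin h) → Fm h) → Fm h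
allAgents {ℕ.zero} f = ¬' (atom 0 ∧' (¬' atom 0))
allAgents {ℕ.suc n} f = bigAnd n f

data Axiom {h : ℕ} : Fm h → Set where
  ax-taut : ∀ {A} → Tautology A → Axiom A
  ax-app  : ∀ {k} (σ : Star k) (t s : Tm h k) (A B : Fm h) →
            Axiom (jst k t (A ⇒ B) ⇒ (jst k s A ⇒ jst k (app σ t s) B))
  ax-sumˡ : ∀ {k} (σ : Star k) (t s : Tm h k) (A : Fm h) →
            Axiom (jst k t A ⇒ jst k (plus σ t s) A)
  ax-sumʳ : ∀ {k} (σ : Star k) (t s : Tm h k) (A : Fm h) →
            Axiom (jst k s A ⇒ jst k (plus σ t s) A)
  ax-refl : ∀ (i : Fin h) (t : Tm h (ag i)) (A : Fm h) →
            Axiom (jst (ag i) t A ⇒ A)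
  ax-pit  : ∀ (i : Fin h) (t : Tm h (ag i)) (A : Fm h) →
            Axiom (jst (ag i) t A ⇒ jst (ag i) (! t) (jst (ag i) t A))
  ax-tup  : ∀ (ts : (i : Fin h) → Tm h (ag i)) (A : Fm h) →
            Axiom (allAgents (λ i → jst (ag i) (ts i) A) ⇒ jst E (tup ts) A)
  ax-proj : ∀ (i : Fin h) (t : Tm h E) (A : Fm h) →
            Axiom (jst E t A ⇒ jst (ag i) (proj i t) A)
  ax-hd   : ∀ (t : Tm h C) (A : Fm h) → Axiom (jst C t A ⇒ jst E (hd t) A)
  ax-tl   : ∀ (t : Tm h C) (A : Fm h) → Axiom (jst C t A ⇒ jst E (tl t) (jst C t A))
  ax-ind  : ∀ (t : Tm h C) (s : Tm h E) (A : Fm h) →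
            Axiom ((A ∧' jst C t (A ⇒ jst E s A)) ⇒ jst C (ind t s) A)

record ConstSpec (h : ℕ) : Set₁ where
  field
    _∋_∶_ : (k : Idx h) → ℕ → Fm h → Set   -- (k ∋ c ∶ A)  means  c:_k A ∈ CS
    onlyAxioms : ∀ {k c A} → _∋_∶_ k c A → Axiom A
open ConstSpec public

CAxAppropriate : {h : ℕ} → ConstSpec h → Set
CAxAppropriate CS = ∀ A → Axiom A → ∃ λ c → _∋_∶_ CS C c A

data _⊢_ {h : ℕ} (CS : ConstSpec h) : Fm h → Set where
  axiom : ∀ {A} → Axiom A → CS ⊢ A
  mp    : ∀ {A B} → CS ⊢ (A ⇒ B) → CS ⊢ A → CS ⊢ B
  nec   : ∀ {k c A} → _∋_∶_ CS k c A → CS ⊢ jst k (cons k c) A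

-- Since CS is C-axiomatically appropriate, the axiom t:C A ⇒ tl(t):E t:C A has a
-- constant c with c:C (t:C A ⇒ tl(t):E t:C A) derivable, and the induction axiom
-- turns t:C A into ind(c, tl t):C t:C A.  For (2), a constant of the axiom
-- t:C A ⇒ hd(t):E A is applied to this witness.
module Submission where

open import Defs
open import Data.Nat using (ℕ; _≤_)
open import Data.Bool using (true; false; not; _∧_; _∨_)
open import Data.Product using (_×_; Σ; _,_; proj₂)
open import Relation.Binary.PropositionalEquality using (_≡_; refl)

syllogism-true : ∀ x y z → not (not x ∨ y) ∨ (not (not y ∨ z) ∨ (not x ∨ z)) ≡ true
syllogism-true true  true  true  = refl
syllogism-true true  true  false = refl
syllogism-true true  false _     = refl
syllogism-true false true  true  = refl
syllogism-true false true  false = refl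
syllogism-true false false _     = refl

∧-intro-true : ∀ k b → not k ∨ (not b ∨ (b ∧ k)) ≡ true
∧-intro-true true  true  = refl
∧-intro-true true  false = refl
∧-intro-true false _     = refl

module _ {h : ℕ} {CS : ConstSpec h} where

  ⇒-trans : ∀ {X Y Z} → CS ⊢ (X ⇒ Y) → CS ⊢ (Y ⇒ Z) → CS ⊢ (X ⇒ Z)
  ⇒-trans {X} {Y} {Z} p q = mp (mp (axiom (ax-taut taut)) p) q
    where
    taut : Tautology ((X ⇒ Y) ⇒ ((Y ⇒ Z) ⇒ (X ⇒ Z)))
    taut v w = syllogism-true (eval v w X) (eval v w Y) (eval v w Z)

  ∧-introʳ : ∀ {K B} → CS ⊢ K → CS ⊢ (B ⇒ (B ∧' K))
  ∧-introʳ {K} {B} k = mp (axiom (ax-taut taut)) k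
    where
    taut : Tautology (K ⇒ (B ⇒ (B ∧' K)))
    taut v w = ∧-intro-true (eval v w K) (eval v w B)

  module _ (appropriate : CAxAppropriate CS) where

    axiom-C-internalized : ∀ {B} → Axiom B → Σ ℕ (λ c → CS ⊢ jst C (cons C c) B)
    axiom-C-internalized {B} ax with appropriate B ax
    ... | c , c∶B = c , nec c∶B

    C-introspection : (t : Tm h C) (A : Fm h) →
                      Σ (Tm h C) (λ u → CS ⊢ (jst C t A ⇒ jst C u (jst C t A)))
    C-introspection t A with axiom-C-internalized (ax-tl t A)
    ... | c , c∶tl = ind (cons C c) (tl t) ,
                     ⇒-trans (∧-introʳ c∶tl) (axiom (ax-ind (cons C c) (tl t) (jst C t A)))

    C-lift-axiom : ∀ {X B D u} → Axiom (B ⇒ D) → CS ⊢ (X ⇒ jst C u B) →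
                   Σ (Tm h C) (λ v → CS ⊢ (X ⇒ jst C v D))
    C-lift-axiom {B = B} {D} {u} ax X⇒u∶B with axiom-C-internalized ax
    ... | c , c∶B⇒D = app star-C (cons C c) u ,
                      ⇒-trans X⇒u∶B (mp (axiom (ax-app star-C (cons C c) u B D)) c∶B⇒D)

lemma2 : (h : ℕ) → 1 ≤ h → (CS : ConstSpec h) → CAxAppropriate CS → (A : Fm h) →
    ((t : Tm h C) → Σ (Tm h C) (λ u → CS ⊢ (jst C t A ⇒ jst C u (jst C t A))))
    × ((t : Tm h C) → Σ (Tm h C) (λ u → CS ⊢ (jst C t A ⇒ jst C u (jst E (hd t) A))))
lemma2 h _ CS appropriate A =
    (λ t → C-introspection appropriate t A)
  , (λ t → C-lift-axiom appropriate (ax-hd t A) (proj₂ (C-introspection appropriate t A)))
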